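{- There is a polynomial-time computable map $(\alpha,\beta)\mapsto\tau$ such that, for all formulas $\alpha,\beta$ (in finitely many variables), $\alpha\models_\Diamond\beta$ iff $\tau$ is a tautology. Conversely, there is a polynomial-time reduction of the tautology problem to the consequence problem $\alpha\models_\Diamond\beta$.
   Context: Let $\mathfrak Z=\{0,1/2,1\}$, with the following binary operations. - $x\wedge y=\min(x,y)$. - $x\sqcup y=x$ if $x=y$, and $x\sqcup y=1/2$ otherwise. - $\partial(x,y)=1/2$ if $y=1/2$. If $y\in\{0,1\}$, then $\partial(x,y)=y$ when $x=y$, and $\partial(x,y)=1-y$ when $x\ne y$. Formulas are built from variables $X_1,X_2,\dots$ and the constant symbols $0,1/2$ using the connectives $\sqcup,\partial,\wedge$. They are evaluated under valuations $v$ of their (finitely many) variables in $\mathfrak Z$, giving values $\hat\phi(v)$. A formula is a tautology iff its value is $1/2$ under every valuation. $\alpha\models_\Diamond\beta$ means: for every valuation $v$, $\hat\alpha(v)\sqcup\hat\beta(v)=\hat\beta(v)$ or $\hat\beta(v)=1/2$. -}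

module Defs where

open import Data.Nat using (ℕ; zero; suc; _+_; _*_; _^_; _≤_)
open import Data.Nat.Binary using (ℕᵇ; 2[1+_]; 1+[2_]) renaming (zero to zeroᵇ)
open import Data.Nat.Binary using (fromℕ)
open import Data.Fin using (Fin)
open import Data.Bool using (Bool; true; false)
open import Data.List using (List; []; _∷_; _++_; length; reverse)
open import Data.Product using (Σ; ∃; _×_; _,_)
open import Data.Sum using (_⊎_)
open import Function.Bundles using (_⇔_)
open import Relation.Binary.PropositionalEquality using (_≡_)

-- The three-element structure 𝔷 = {0, 1/2, 1}

data Z3 : Set where
  z0 : Z3
  zh : Z3
  z1 : Z3

_∧ᶻ_ : Z3 → Z3 → Z3
z0 ∧ᶻ y  = z0
zh ∧ᶻ z0 = z0
zh ∧ᶻ y  = zh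
z1 ∧ᶻ y  = y

_⊔ᶻ_ : Z3 → Z3 → Z3
z0 ⊔ᶻ z0 = z0
zh ⊔ᶻ zh = zh
z1 ⊔ᶻ z1 = z1
_  ⊔ᶻ _  = zh

∂ᶻ : Z3 → Z3 → Z3
∂ᶻ x  zh = zh
∂ᶻ z0 z0 = z0
∂ᶻ _  z0 = z1
∂ᶻ z1 z1 = z1
∂ᶻ _  z1 = z0

data Formula : Set where
  var  : ℕ → Formula
  c0   : Formula
  chalf : Formula
  _⊔_  : Formula → Formula → Formula
  ∂    : Formula → Formula → Formula
  _∧_  : Formula → Formula → Formula

-- A valuation assigns a value to every variable; a formula only uses
-- finitely many, so this is equivalent to quantifying over valuations
-- of its variables.
Valuation : Set
Valuation = ℕ → Z3

⟦_⟧ : Formula → Valuation → Z3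
⟦ var i ⟧ v   = v i
⟦ c0 ⟧ v      = z0
⟦ chalf ⟧ v   = zh
⟦ φ ⊔ ψ ⟧ v   = ⟦ φ ⟧ v ⊔ᶻ ⟦ ψ ⟧ v
⟦ ∂ φ ψ ⟧ v   = ∂ᶻ (⟦ φ ⟧ v) (⟦ ψ ⟧ v)
⟦ φ ∧ ψ ⟧ v   = ⟦ φ ⟧ v ∧ᶻ ⟦ ψ ⟧ v

Tautology : Formula → Set
Tautology φ = ∀ (v : Valuation) → ⟦ φ ⟧ v ≡ zh

_⊨◇_ : Formula → Formula → Set
α ⊨◇ β = ∀ (v : Valuation) →
  ((⟦ α ⟧ v ⊔ᶻ ⟦ β ⟧ v) ≡ ⟦ β ⟧ v) ⊎ (⟦ β ⟧ v ≡ zh)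

-- Encoding of formulas as words over a finite alphabet
-- (Polish prefix notation; variable indices in bijective binary)

data Sym : Set where
  sJoin sDel sMeet sZero sHalf sVar sD1 sD2 sEnd sComma : Sym

encℕᵇ : ℕᵇ → List Sym
encℕᵇ zeroᵇ    = []
encℕᵇ 1+[2 n ] = sD1 ∷ encℕᵇ n
encℕᵇ 2[1+ n ] = sD2 ∷ encℕᵇ n

enc : Formula → List Sym
enc (var i)  = sVar ∷ (encℕᵇ (fromℕ i) ++ (sEnd ∷ []))
enc c0       = sZero ∷ []
enc chalf    = sHalf ∷ []
enc (φ ⊔ ψ)  = sJoin ∷ (enc φ ++ enc ψ)
enc (∂ φ ψ)  = sDel ∷ (enc φ ++ enc ψ)
enc (φ ∧ ψ)  = sMeet ∷ (enc φ ++ enc ψ)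

encPair : Formula → Formula → List Sym
encPair α β = enc α ++ (sComma ∷ enc β)

data Cell (k : ℕ) : Set where
  blank : Cell k
  sym   : Sym → Cell k
  aux   : Fin k → Cell k

data Move : Set where
  left right stay : Move

record TM : Set where
  field
    nStates : ℕ
    nAux    : ℕ
    start   : Fin nStates
    halting : Fin nStates → Bool
    δ       : Fin nStates → Cell nAux → Fin nStates × Cell nAux × Move

-- configuration: state, cells left of the head (reversed), cells from the head on
record Config (M : TM) : Set where
  constructor cfg
  field
    state : Fin (TM.nStates M)
    lft   : List (Cell (TM.nAux M))
    rgt   : List (Cell (TM.nAux M))

module _ (M : TM) where
  open TM M

  private
    C = Cell nAux

    headOf : List C → C
    headOf []      = blank
    headOf (c ∷ _) = c

    tailOf : List C → List C
    tailOf []      = []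
    tailOf (_ ∷ r) = r

    move : Fin nStates → C → Move → List C → List C → Config M
    move q c left  []      r = cfg q [] (c ∷ r)          -- left end: stay
    move q c left  (a ∷ l) r = cfg q l (a ∷ c ∷ r)
    move q c right l       r = cfg q (c ∷ l) r
    move q c stay  l       r = cfg q l (c ∷ r)

    stepWith : Bool → Config M → Config M
    stepWith true  κ = κ
    stepWith false (cfg q l r) with δ q (headOf r)
    ... | q' , c , m = move q' c m l (tailOf r)

  step : Config M → Config M
  step κ = stepWith (halting (Config.state κ)) κ

  run : ℕ → Config M → Config M
  run zero    κ = κ
  run (suc t) κ = run t (step κ)

  initial : List Sym → Config M
  initial w = cfg start [] (Data.List.map sym w)

  Halted : Config M → Set
  Halted κ = halting (Config.state κ) ≡ true

  -- output: maximal word of input symbols at the left end of the tape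
  private
    symPrefix : List C → List Sym
    symPrefix []            = []
    symPrefix (sym s ∷ r)   = s ∷ symPrefix r
    symPrefix (blank ∷ r)   = []
    symPrefix (aux _ ∷ r)   = []

  output : Config M → List Sym
  output (cfg _ l r) = symPrefix (reverse l ++ r)

PolyTime : (List Sym → List Sym) → Set
PolyTime f = Σ TM λ M → Σ ℕ λ c → Σ ℕ λ d → ∀ (w : List Sym) →
  Σ ℕ λ t → (t ≤ c * length w ^ d + c) ×
    Halted M (run M t (initial M w)) ×
    (output M (run M t (initial M w)) ≡ f w)

-- For b ∈ {0,1} the value ∂(a,b) is b exactly when a = b, while ∂(½,b) = 1 − b; both are ½
-- when b = ½.  Hence ∂(a,b) ⊔ ∂(½,b) = ½ iff a = b or b = ½, which is the pointwise meaning of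
-- a ⊨◇ b, so α ⊨◇ β iff τ α β = ∂(α, β ∧ ∂(½,0)) ⊔ ∂(½,β) is a tautology.  Conversely φ is a
-- tautology iff ½ ⊨◇ φ, because ½ ⊔ b = b forces b = ½.
--
-- Prepending "½ ," is a shift
-- of the input by two cells (linear time).  Turning "α , β" into τ α β is the same shift
-- followed by copying β behind the tape with the usual mark-carry-return loop (quadratic time).
module Submission where

open import Defs
open import Data.List using (List)
open import Data.Product using (Σ; _×_)
open import Function.Bundles using (_⇔_)
open import Relation.Binary.PropositionalEquality using (_≡_)

open import Data.Bool using (Bool; true; false)
open import Data.Fin using (Fin)
open import Data.Fin.Patterns using (0F; 1F; 2F; 3F; 4F; 5F; 6F; 7F; 8F; 9F)
open import Data.Fin.Properties using (+↔⊎; *↔×)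
open import Data.List using ([]; _∷_; _++_; _ʳ++_; map; drop; reverse; length)
open import Data.List.Properties
  using (map-++; map-∘; map-ʳ++; reverse-map; length-map; length-++; length-ʳ++; length-reverse;
         ++-assoc; ++-identityʳ; ʳ++-defn; ++-ʳ++; ʳ++-ʳ++)
open import Data.List.Relation.Unary.All using (All; []; _∷_)
import Data.List.Relation.Unary.All as All
import Data.List.Relation.Unary.All.Properties as All
open import Data.List.Relation.Binary.Pointwise using (Pointwise; []; _∷_)
import Data.List.Relation.Binary.Pointwise as Pointwise
open import Data.Nat using (ℕ; zero; suc; _+_; _*_; _^_; _≤_; z≤n; _∸_)
open import Data.Nat.Binary using (2[1+_]; 1+[2_]) renaming (zero to zeroᵇ; fromℕ to fromℕᵇ)
import Data.Nat.Properties as ℕ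
open import Data.Nat.Tactic.RingSolver using (solve-∀)
open import Data.Product using (_,_; ∃-syntax; proj₁; proj₂)
open import Data.Product.Function.NonDependent.Propositional using (_×-↩_)
open import Data.Sum using (_⊎_; inj₁; inj₂; [_,_]′)
open import Data.Sum.Function.Propositional using (_⊎-↩_)
open import Function.Base using (id)
open import Function.Bundles using (_↩_; mk↩; mk⇔; module LeftInverse; module Equivalence)
open import Function.Construct.Composition using (_↩-∘_)
open import Function.Construct.Identity using (↩-id)
open import Function.Properties.Inverse using (↔⇒↩)
open import Relation.Binary.PropositionalEquality as ≡
  using (refl; trans; cong; cong₂; subst; subst₂; module ≡-Reasoning)

ʳ++-++ : ∀ {A : Set} (xs : List A) {ys zs} → (xs ʳ++ ys) ++ zs ≡ xs ʳ++ ys ++ zs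
ʳ++-++ []       = refl
ʳ++-++ (x ∷ xs) = ʳ++-++ xs

All-ʳ++⁺ : ∀ {A : Set} {P : A → Set} {xs ys} → All P xs → All P ys → All P (xs ʳ++ ys)
All-ʳ++⁺ []         pys = pys
All-ʳ++⁺ (px ∷ pxs) pys = All-ʳ++⁺ pxs (px ∷ pys)

length-≤-++-∷ : ∀ {A : Set} (u : List A) {c} v → length v ≤ length (u ++ c ∷ v)
length-≤-++-∷ u v = subst (length v ≤_) (≡.sym (length-++ u)) (ℕ.≤-trans (ℕ.n≤1+n _) (ℕ.m≤n+m _ (length u)))

n≤n^2 : ∀ n → n ≤ n ^ 2
n≤n^2 zero      = z≤n
n≤n^2 n@(suc _) = ℕ.m≤m*n n (n * 1)

-- Machines with named states

Enumeration : Set → Set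
Enumeration A = ∃[ n ] Fin n ↩ A

enumerate-Fin : ∀ n → Enumeration (Fin n)
enumerate-Fin n = n , ↩-id (Fin n)

enumerate-⊎ : ∀ {A B} → Enumeration A → Enumeration B → Enumeration (A ⊎ B)
enumerate-⊎ (m , a) (n , b) = m + n , (a ⊎-↩ b) ↩-∘ ↔⇒↩ +↔⊎

enumerate-× : ∀ {A B} → Enumeration A → Enumeration B → Enumeration (A × B)
enumerate-× (m , a) (n , b) = m * n , (a ×-↩ b) ↩-∘ ↔⇒↩ *↔×

symbolAt : Fin 10 → Sym
symbolAt 0F = sJoin
symbolAt 1F = sDel
symbolAt 2F = sMeet
symbolAt 3F = sZero
symbolAt 4F = sHalf
symbolAt 5F = sVar
symbolAt 6F = sD1
symbolAt 7F = sD2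
symbolAt 8F = sEnd
symbolAt 9F = sComma

indexOf : Sym → Fin 10
indexOf sJoin  = 0F
indexOf sDel   = 1F
indexOf sMeet  = 2F
indexOf sZero  = 3F
indexOf sHalf  = 4F
indexOf sVar   = 5F
indexOf sD1    = 6F
indexOf sD2    = 7F
indexOf sEnd   = 8F
indexOf sComma = 9F

symbolAt-indexOf : ∀ s → symbolAt (indexOf s) ≡ s
symbolAt-indexOf sJoin  = refl
symbolAt-indexOf sDel   = refl
symbolAt-indexOf sMeet  = refl
symbolAt-indexOf sZero  = refl
symbolAt-indexOf sHalf  = refl
symbolAt-indexOf sVar   = refl
symbolAt-indexOf sD1    = refl
symbolAt-indexOf sD2    = refl
symbolAt-indexOf sEnd   = refl
symbolAt-indexOf sComma = refl

enumerate-Sym : Enumeration Sym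
enumerate-Sym = 10 , mk↩ {to = symbolAt} {from = indexOf} λ { {s} refl → symbolAt-indexOf s }

-- A TM numbers its states and auxiliary symbols by Fin; in a Machine they range over enumerated
-- types and compile numbers them.  Runs are computed on unnumbered configurations, where every
-- transition reduces definitionally.

data Tile (A : Set) : Set where
  blank : Tile A
  sym   : Sym → Tile A
  aux   : A → Tile A

record Machine : Set₁ where
  field
    State Aux : Set
    states    : Enumeration State
    auxiliary : Enumeration Aux
    start     : State
    halts     : State → Bool
    δ         : State → Tile Aux → State × Tile Aux × Move

output-map-sym : ∀ (M : TM) q xs → output M (cfg q [] (map sym xs)) ≡ xs
output-map-sym M q []       = refl
output-map-sym M q (x ∷ xs) = cong (x ∷_) (output-map-sym M q xs)

outputWithin : (M : TM) → (List Sym → ℕ) → List Sym → List Sym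
outputWithin M T w = output M (run M (T w) (initial M w))

module Run (m : Machine) where
  open Machine m

  Tape : Set
  Tape = List (Tile Aux)

  record Conf : Set where
    constructor conf
    field
      state : State
      lft   : Tape
      rgt   : Tape

  scanned : Tape → Tile Aux
  scanned []      = blank
  scanned (c ∷ _) = c

  moveTo : State → Tile Aux → Move → Tape → Tape → Conf
  moveTo s c left  []      r = conf s [] (c ∷ r)
  moveTo s c left  (a ∷ l) r = conf s l (a ∷ c ∷ r)
  moveTo s c right l       r = conf s (c ∷ l) r
  moveTo s c stay  l       r = conf s l (c ∷ r)

  stepₘ : Conf → Conf
  stepₘ (conf s l r) with halts s | δ s (scanned r)
  ... | true  | _           = conf s l r
  ... | false | s′ , c , mv = moveTo s′ c mv l (drop 1 r)

  runₘ : ℕ → Conf → Conf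
  runₘ zero    κ = κ
  runₘ (suc t) κ = runₘ t (stepₘ κ)

  initialₘ : List Sym → Conf
  initialₘ w = conf start [] (map sym w)

  Halts : Conf → Set
  Halts κ = halts (Conf.state κ) ≡ true

  contents : Conf → Tape
  contents (conf _ l r) = reverse l ++ r

  infix  4 _⟶[_]_
  infixr 5 _▸_

  _⟶[_]_ : Conf → ℕ → Conf → Set
  κ ⟶[ n ] κ′ = ∃[ t ] t ≤ n × runₘ t κ ≡ κ′

  runₘ-+ : ∀ s t κ → runₘ (s + t) κ ≡ runₘ t (runₘ s κ)
  runₘ-+ zero    t κ = refl
  runₘ-+ (suc s) t κ = runₘ-+ s t (stepₘ κ)

  ⟶-refl : ∀ {κ} → κ ⟶[ 0 ] κ
  ⟶-refl = 0 , z≤n , refl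

  ⟶-step : ∀ {κ} → κ ⟶[ 1 ] stepₘ κ
  ⟶-step = 1 , ℕ.≤-refl , refl

  _▸_ : ∀ {κ κ′ κ″ m n} → κ ⟶[ m ] κ′ → κ′ ⟶[ n ] κ″ → κ ⟶[ m + n ] κ″
  _▸_ {κ} (s , s≤m , refl) (t , t≤n , refl) = s + t , ℕ.+-mono-≤ s≤m t≤n , runₘ-+ s t κ

  weaken : ∀ {κ κ′ m n} → m ≤ n → κ ⟶[ m ] κ′ → κ ⟶[ n ] κ′
  weaken m≤n (t , t≤m , eq) = t , ℕ.≤-trans t≤m m≤n , eq

  runₘ-halted : ∀ t {κ} → Halts κ → runₘ t κ ≡ κ
  runₘ-halted zero    h = refl
  runₘ-halted (suc t) {conf s l r} h with halts s | h
  ... | true | _ = runₘ-halted t h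

  runₘ-reaches-halted : ∀ {κ κ′ n} → κ ⟶[ n ] κ′ → Halts κ′ → runₘ n κ ≡ κ′
  runₘ-reaches-halted {κ} {n = n} (t , t≤n , refl) h = begin
    runₘ n κ                ≡⟨ cong (λ k → runₘ k κ) (ℕ.m+[n∸m]≡n t≤n) ⟨
    runₘ (t + (n ∸ t)) κ    ≡⟨ runₘ-+ t (n ∸ t) κ ⟩
    runₘ (n ∸ t) (runₘ t κ) ≡⟨ runₘ-halted (n ∸ t) h ⟩
    runₘ t κ                ∎
    where open ≡-Reasoning

  HaltsWithin : (ℕ → ℕ) → Set
  HaltsWithin B = ∀ w → ∃[ κ ] initialₘ w ⟶[ B (length w) ] κ × Halts κ

  private
    module S = LeftInverse (proj₂ states)
    module A = LeftInverse (proj₂ auxiliary)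

  encodeTile : Tile Aux → Cell (proj₁ auxiliary)
  encodeTile blank   = blank
  encodeTile (sym s) = sym s
  encodeTile (aux a) = aux (A.from a)

  decodeTile : Cell (proj₁ auxiliary) → Tile Aux
  decodeTile blank   = blank
  decodeTile (sym s) = sym s
  decodeTile (aux k) = aux (A.to k)

  decodeTile-encodeTile : ∀ c → decodeTile (encodeTile c) ≡ c
  decodeTile-encodeTile blank   = refl
  decodeTile-encodeTile (sym s) = refl
  decodeTile-encodeTile (aux a) = cong aux (A.strictlyInverseˡ a)

  compile : TM
  compile = record
    { nStates = proj₁ states
    ; nAux    = proj₁ auxiliary
    ; start   = S.from start
    ; halting = λ q → halts (S.to q)
    ; δ       = λ q c → encodeResult (δ (S.to q) (decodeTile c))
    }
    where
    encodeResult : State × Tile Aux × Move → Fin (proj₁ states) × Cell (proj₁ auxiliary) × Move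
    encodeResult (s , c , mv) = S.from s , encodeTile c , mv

  encodeConf : Conf → Config compile
  encodeConf (conf s l r) = cfg (S.from s) (map encodeTile l) (map encodeTile r)

  -- The state is decoded twice: once to decide halting, once to look up the transition.
  step-encodeConf : ∀ κ → step compile (encodeConf κ) ≡ encodeConf (stepₘ κ)
  step-encodeConf (conf s l []) rewrite S.strictlyInverseˡ s with halts s
  ... | true  = refl
  ... | false rewrite S.strictlyInverseˡ s with δ s blank | l
  ...   | _ , _ , right | _     = refl
  ...   | _ , _ , stay  | _     = refl
  ...   | _ , _ , left  | []    = refl
  ...   | _ , _ , left  | _ ∷ _ = refl
  step-encodeConf (conf s l (c ∷ r)) rewrite S.strictlyInverseˡ s with halts s
  ... | true  = refl
  ... | false rewrite S.strictlyInverseˡ s | decodeTile-encodeTile c with δ s c | l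
  ...   | _ , _ , right | _     = refl
  ...   | _ , _ , stay  | _     = refl
  ...   | _ , _ , left  | []    = refl
  ...   | _ , _ , left  | _ ∷ _ = refl

  run-encodeConf : ∀ t κ → run compile t (encodeConf κ) ≡ encodeConf (runₘ t κ)
  run-encodeConf zero    κ = refl
  run-encodeConf (suc t) κ = trans (cong (run compile t) (step-encodeConf κ)) (run-encodeConf t (stepₘ κ))

  initial-encodeConf : ∀ w → initial compile w ≡ encodeConf (initialₘ w)
  initial-encodeConf w = cong (cfg (S.from start) []) (map-∘ w)

  halted-encodeConf : ∀ {κ} → Halts κ → Halted compile (encodeConf κ)
  halted-encodeConf {conf s _ _} h = trans (cong halts (S.strictlyInverseˡ s)) h

  output-encodeConf : ∀ {κ xs} → contents κ ≡ map sym xs → output compile (encodeConf κ) ≡ xs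
  output-encodeConf {conf s l r} {xs} eq =
    trans (cong (λ t → output compile (cfg (S.from s) [] t)) encoded-contents)
          (output-map-sym compile (S.from s) xs)
    where
    open ≡-Reasoning
    encoded-contents : reverse (map encodeTile l) ++ map encodeTile r ≡ map sym xs
    encoded-contents = begin
      reverse (map encodeTile l) ++ map encodeTile r ≡⟨ cong (_++ map encodeTile r) (reverse-map encodeTile l) ⟨
      map encodeTile (reverse l) ++ map encodeTile r ≡⟨ map-++ encodeTile (reverse l) r ⟨
      map encodeTile (reverse l ++ r)                ≡⟨ cong (map encodeTile) eq ⟩
      map encodeTile (map sym xs)                    ≡⟨ map-∘ xs ⟨
      map sym xs                                     ∎

  run-compile : ∀ {w n κ} → initialₘ w ⟶[ n ] κ → Halts κ → run compile n (initial compile w) ≡ encodeConf κ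
  run-compile {w} {n} reach h = begin
    run compile n (initial compile w)       ≡⟨ cong (run compile n) (initial-encodeConf w) ⟩
    run compile n (encodeConf (initialₘ w)) ≡⟨ run-encodeConf n (initialₘ w) ⟩
    encodeConf (runₘ n (initialₘ w))        ≡⟨ cong encodeConf (runₘ-reaches-halted reach h) ⟩
    encodeConf _                            ∎
    where open ≡-Reasoning

  compile-polyTime : ∀ c d → HaltsWithin (λ n → c * n ^ d + c) →
                     PolyTime (outputWithin compile (λ w → c * length w ^ d + c))
  compile-polyTime c d halting = compile , c , d , λ w →
    let κ , reach , h = halting w in
    _ , ℕ.≤-refl , subst (Halted compile) (≡.sym (run-compile reach h)) (halted-encodeConf {κ} h) , refl

  outputWithin-compile : ∀ {T w κ xs} → initialₘ w ⟶[ T w ] κ → Halts κ → contents κ ≡ map sym xs →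
                         outputWithin compile T w ≡ xs
  outputWithin-compile {κ = κ} reach h eq =
    trans (cong (output compile) (run-compile reach h)) (output-encodeConf {κ} eq)

-- ∂ ½ 0 denotes 1, so β ∧ ∂ ½ 0 means β; the conjunction is there so that a machine can produce
-- enc (τ α β) from "enc α , enc β" by overwriting the comma with ∧.
τ : Formula → Formula → Formula
τ α β = ∂ α (β ∧ ∂ chalf c0) ⊔ ∂ chalf β

consequenceᶻ⇔τᶻ-half : ∀ a b → (((a ⊔ᶻ b) ≡ b) ⊎ (b ≡ zh)) ⇔ ((∂ᶻ a (b ∧ᶻ z1) ⊔ᶻ ∂ᶻ zh b) ≡ zh)
consequenceᶻ⇔τᶻ-half a b = mk⇔ (to a b) (from a b)
  where
  to : ∀ a b → ((a ⊔ᶻ b) ≡ b) ⊎ (b ≡ zh) → (∂ᶻ a (b ∧ᶻ z1) ⊔ᶻ ∂ᶻ zh b) ≡ zh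
  to _  _  (inj₂ refl) = refl
  to _  zh (inj₁ _)    = refl
  to z0 z0 (inj₁ _)    = refl
  to z1 z1 (inj₁ _)    = refl
  to zh z0 (inj₁ ())
  to z1 z0 (inj₁ ())
  to z0 z1 (inj₁ ())
  to zh z1 (inj₁ ())
  from : ∀ a b → (∂ᶻ a (b ∧ᶻ z1) ⊔ᶻ ∂ᶻ zh b) ≡ zh → ((a ⊔ᶻ b) ≡ b) ⊎ (b ≡ zh)
  from _  zh _ = inj₂ refl
  from z0 z0 _ = inj₁ refl
  from z1 z1 _ = inj₁ refl
  from zh z0 ()
  from z1 z0 ()
  from z0 z1 ()
  from zh z1 ()

⊨◇⇔Tautology-τ : ∀ α β → (α ⊨◇ β) ⇔ Tautology (τ α β)
⊨◇⇔Tautology-τ α β =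
  mk⇔ (λ h v → Equivalence.to (consequenceᶻ⇔τᶻ-half _ _) (h v)) (λ h v → Equivalence.from (consequenceᶻ⇔τᶻ-half _ _) (h v))

Tautology⇔half-⊨◇ : ∀ φ → Tautology φ ⇔ (chalf ⊨◇ φ)
Tautology⇔half-⊨◇ φ = mk⇔ (λ h v → inj₂ (h v)) (λ h v → [ half-⊔ᶻ , id ]′ (h v))
  where
  half-⊔ᶻ : ∀ {b} → (zh ⊔ᶻ b) ≡ b → b ≡ zh
  half-⊔ᶻ {zh} _ = refl
  half-⊔ᶻ {z0} ()
  half-⊔ᶻ {z1} ()

glue : List Sym
glue = sHalf ∷ sZero ∷ sDel ∷ sHalf ∷ []

tautologyWord : List Sym → List Sym → List Sym
tautologyWord u v = sJoin ∷ sDel ∷ u ++ sMeet ∷ v ++ sDel ∷ glue ++ v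

enc-τ : ∀ α β → enc (τ α β) ≡ tautologyWord (enc α) (enc β)
enc-τ α β = cong (λ t → sJoin ∷ sDel ∷ t) (begin
  (enc α ++ sMeet ∷ enc β ++ sDel ∷ sHalf ∷ sZero ∷ []) ++ sDel ∷ sHalf ∷ enc β ≡⟨ ++-assoc (enc α) _ _ ⟩
  enc α ++ sMeet ∷ (enc β ++ sDel ∷ sHalf ∷ sZero ∷ []) ++ sDel ∷ sHalf ∷ enc β ≡⟨ cong (λ t → enc α ++ sMeet ∷ t) (++-assoc (enc β) _ _) ⟩
  enc α ++ sMeet ∷ enc β ++ sDel ∷ glue ++ enc β                                 ∎)
  where open ≡-Reasoning

isComma : Sym → Bool
isComma sComma = true
isComma _      = false

NotComma : Sym → Set
NotComma s = isComma s ≡ false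

replaceComma : Sym → Sym
replaceComma s with isComma s
... | true  = sMeet
... | false = s

map-replaceComma : ∀ {u} → All NotComma u → map replaceComma u ≡ u
map-replaceComma []                 = refl
map-replaceComma {c ∷ _} (nc ∷ ncs) rewrite nc = cong (c ∷_) (map-replaceComma ncs)

data CommaSplit : List Sym → Set where
  no-comma   : ∀ {w} → All NotComma w → CommaSplit w
  last-comma : ∀ u {c} v → isComma c ≡ true → All NotComma v → CommaSplit (u ++ c ∷ v)

commaSplit : ∀ w → CommaSplit w
commaSplit []      = no-comma []
commaSplit (z ∷ w) with commaSplit w
... | last-comma u v comma nv = last-comma (z ∷ u) v comma nv
... | no-comma nw with isComma z in comma
...   | true  = last-comma [] w comma nw
...   | false = no-comma (comma ∷ nw)

encℕᵇ-noComma : ∀ n → All NotComma (encℕᵇ n)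
encℕᵇ-noComma zeroᵇ    = []
encℕᵇ-noComma 1+[2 n ] = refl ∷ encℕᵇ-noComma n
encℕᵇ-noComma 2[1+ n ] = refl ∷ encℕᵇ-noComma n

enc-noComma : ∀ φ → All NotComma (enc φ)
enc-noComma (var i) = refl ∷ All.++⁺ (encℕᵇ-noComma (fromℕᵇ i)) (refl ∷ [])
enc-noComma c0      = refl ∷ []
enc-noComma chalf   = refl ∷ []
enc-noComma (φ ⊔ ψ) = refl ∷ All.++⁺ (enc-noComma φ) (enc-noComma ψ)
enc-noComma (∂ φ ψ) = refl ∷ All.++⁺ (enc-noComma φ) (enc-noComma ψ)
enc-noComma (φ ∧ ψ) = refl ∷ All.++⁺ (enc-noComma φ) (enc-noComma ψ)

Aux : Set
Aux = Sym ⊎ Fin 3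

pattern marked s  = aux (inj₁ s)
pattern commaMark = aux (inj₂ 0F)
pattern separator = aux (inj₂ 1F)
pattern leftEnd   = aux (inj₂ 2F)

State : Set
State = Fin 10 ⊎ Sym ⊎ Sym ⊎ Sym × Sym

pattern start     = inj₁ 0F
pattern append₀   = inj₁ 1F
pattern append₁   = inj₁ 2F
pattern append₂   = inj₁ 3F
pattern append₃   = inj₁ 4F
pattern append₄   = inj₁ 5F
pattern seek      = inj₁ 6F
pattern copy      = inj₁ 7F
pattern finish    = inj₁ 8F
pattern halt      = inj₁ 9F
pattern flush y   = inj₂ (inj₁ y)
pattern carry s   = inj₂ (inj₂ (inj₁ s))
pattern shift x y = inj₂ (inj₂ (inj₂ (x , y)))

data Reduction : Set where
  pairToTautology formulaToPair : Reduction

markComma : Sym → Tile Aux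
markComma s with isComma s
... | true  = commaMark
... | false = sym s

firstCell : Reduction → Tile Aux
firstCell pairToTautology = leftEnd
firstCell formulaToPair   = sym sHalf

secondSymbol : Reduction → Sym
secondSymbol pairToTautology = sDel
secondSymbol formulaToPair   = sComma

translate : Reduction → Sym → Tile Aux
translate pairToTautology = markComma
translate formulaToPair   = sym

afterShift : Reduction → State
afterShift pairToTautology = append₀
afterShift formulaToPair   = halt

halts : State → Bool
halts halt = true
halts _    = false

-- formulaToPair only shifts the input two cells to the right behind ½ ,.  On input u , v, with
-- v after the last comma, pairToTautology shifts it behind leftEnd ∂, marking commas, and
-- appends separator ½ 0 ∂ ½.  It then marks the symbols of v one at a time, carrying each to
-- the right end and seeking back to the marks (an input without comma makes this first seek
-- reach leftEnd and halt).  At the separator, which becomes ∂, it walks back to leftEnd, which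
-- becomes ⊔, unmarking symbols and turning marked commas into ∧.
δ : Reduction → State → Tile Aux → State × Tile Aux × Move
δ r start (sym z)       = shift (secondSymbol r) z , firstCell r , right
δ r start _             = flush (secondSymbol r) , firstCell r , right
δ r (shift x y) (sym z) = shift y z , translate r x , right
δ r (shift x y) _       = flush y , translate r x , right
δ r (flush y) _         = afterShift r , translate r y , right
δ _ append₀ _           = append₁ , separator , right
δ _ append₁ _           = append₂ , sym sHalf , right
δ _ append₂ _           = append₃ , sym sZero , right
δ _ append₃ _           = append₄ , sym sDel , right
δ _ append₄ _           = seek , sym sHalf , left
δ _ seek (sym x)        = seek , sym x , left
δ _ seek separator      = seek , separator , left
δ _ seek (marked s)     = copy , marked s , right
δ _ seek commaMark      = copy , commaMark , right
δ _ seek leftEnd        = halt , leftEnd , stay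
δ _ copy (sym s)        = carry s , marked s , right
δ _ copy separator      = finish , sym sDel , left
δ _ (carry s) (sym x)   = carry s , sym x , right
δ _ (carry s) separator = carry s , separator , right
δ _ (carry s) blank     = seek , sym s , left
δ _ finish (sym x)      = finish , sym x , left
δ _ finish (marked s)   = finish , sym s , left
δ _ finish commaMark    = finish , sym sMeet , left
δ _ finish leftEnd      = halt , sym sJoin , stay
δ _ s c                 = halt , c , stay

machine : Reduction → Machine
machine r = record
  { State     = State
  ; Aux       = Aux
  ; states    = enumerate-⊎ (enumerate-Fin 10)
                  (enumerate-⊎ enumerate-Sym (enumerate-⊎ enumerate-Sym (enumerate-× enumerate-Sym enumerate-Sym)))
  ; auxiliary = enumerate-⊎ enumerate-Sym (enumerate-Fin 3)
  ; start     = start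
  ; halts     = halts
  ; δ         = δ r
  }

module _ (r : Reduction) where
  open Run (machine r)

  shift-phase : ∀ w → initialₘ w ⟶[ length w + 2 ]
                conf (afterShift r) (map (translate r) (secondSymbol r ∷ w) ʳ++ firstCell r ∷ []) []
  shift-phase []      = ⟶-step ▸ ⟶-step
  shift-phase (z ∷ w) = ⟶-step ▸ shifting (secondSymbol r) z w
    where
    shifting : ∀ x y w {l} → conf (shift x y) l (map sym w) ⟶[ length w + 2 ]
               conf (afterShift r) (map (translate r) (x ∷ y ∷ w) ʳ++ l) []
    shifting x y []      = ⟶-step ▸ ⟶-step
    shifting x y (z ∷ w) = ⟶-step ▸ shifting y z w

-- Reducing consequence to tautology

data Passable : Tile Aux → Set where
  sym-passable       : ∀ x → Passable (sym x)
  separator-passable : Passable separator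

all-sym-passable : ∀ xs → All Passable (map sym xs)
all-sym-passable xs = All.map⁺ (All.universal sym-passable xs)

data Restores : Tile Aux → Sym → Set where
  unchanged   : ∀ x → Restores (sym x) x
  unmark      : ∀ s → Restores (marked s) s
  unmarkComma : Restores commaMark sMeet

markComma-comma : ∀ {c} → isComma c ≡ true → markComma c ≡ commaMark
markComma-comma {c} comma rewrite comma = refl

map-markComma : ∀ {v} → All NotComma v → map markComma v ≡ map sym v
map-markComma []                 = refl
map-markComma {c ∷ _} (nc ∷ ncs) rewrite nc = cong (sym c ∷_) (map-markComma ncs)

markComma-restores : ∀ s → Restores (markComma s) (replaceComma s)
markComma-restores s with isComma s
... | true  = unmarkComma
... | false = unchanged s

map-markComma-restores : ∀ u → Pointwise Restores (map markComma u) (map replaceComma u)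
map-markComma-restores []      = []
map-markComma-restores (s ∷ u) = markComma-restores s ∷ map-markComma-restores u

map-marked-restores : ∀ v → Pointwise Restores (map (λ s → marked s) v) v
map-marked-restores []      = []
map-marked-restores (s ∷ v) = unmark s ∷ map-marked-restores v

copy-cost-bound : ∀ {n b} → b ≤ n → n + 2 + (b + 9 + (1 + (b * (2 * b + 11) + (n + 3)))) ≤ 16 * n ^ 2 + 16
copy-cost-bound {n} {b} b≤n = begin
  n + 2 + (b + 9 + (1 + (b * (2 * b + 11) + (n + 3))))
    ≤⟨ ℕ.+-monoʳ-≤ (n + 2) (ℕ.+-mono-≤ (ℕ.+-monoˡ-≤ 9 b≤n) (ℕ.+-monoʳ-≤ 1 (ℕ.+-monoˡ-≤ (n + 3)
         (ℕ.*-mono-≤ b≤n (ℕ.+-monoˡ-≤ 11 (ℕ.*-monoʳ-≤ 2 b≤n)))))) ⟩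
  n + 2 + (n + 9 + (1 + (n * (2 * n + 11) + (n + 3))))   ≡⟨ expand n ⟩
  2 * n ^ 2 + 14 * n + 15                                ≤⟨ ℕ.+-monoˡ-≤ 15 (ℕ.+-monoʳ-≤ (2 * n ^ 2) (ℕ.*-monoʳ-≤ 14 (n≤n^2 n))) ⟩
  2 * n ^ 2 + 14 * n ^ 2 + 15                            ≡⟨ collect n ⟩
  16 * n ^ 2 + 15                                        ≤⟨ ℕ.+-monoʳ-≤ (16 * n ^ 2) (ℕ.n≤1+n 15) ⟩
  16 * n ^ 2 + 16                                        ∎
  where
  open ℕ.≤-Reasoning
  expand : ∀ m → m + 2 + (m + 9 + (1 + (m * (2 * m + 11) + (m + 3)))) ≡ 2 * (m * (m * 1)) + 14 * m + 15
  expand = solve-∀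
  collect : ∀ m → 2 * (m * (m * 1)) + 14 * (m * (m * 1)) + 15 ≡ 16 * (m * (m * 1)) + 15
  collect = solve-∀

no-comma-cost-bound : ∀ n → n + 2 + (suc n + 9 + 1) ≤ 16 * n ^ 2 + 16
no-comma-cost-bound n = ℕ.≤-trans (ℕ.≤-trans (ℕ.m≤m+n _ 2) (ℕ.≤-reflexive (arithmetic n))) (copy-cost-bound z≤n)
  where
  arithmetic : ∀ m → m + 2 + (1 + m + 9 + 1) + 2 ≡ m + 2 + (0 + 9 + (1 + (0 * (2 * 0 + 11) + (m + 3))))
  arithmetic = solve-∀

module _ where
  open Run (machine pairToTautology)

  append-phase : ∀ {l} → conf append₀ l [] ⟶[ 5 ]
                 conf seek (sym sZero ∷ sym sHalf ∷ separator ∷ l) (sym sDel ∷ sym sHalf ∷ [])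
  append-phase = ⟶-step ▸ ⟶-step ▸ ⟶-step ▸ ⟶-step ▸ ⟶-step

  seek-step : ∀ {c a l r} → Passable c → conf seek (a ∷ l) (c ∷ r) ⟶[ 1 ] conf seek l (a ∷ c ∷ r)
  seek-step (sym-passable x)   = ⟶-step
  seek-step separator-passable = ⟶-step

  carry-step : ∀ {s c l r} → Passable c → conf (carry s) l (c ∷ r) ⟶[ 1 ] conf (carry s) (c ∷ l) r
  carry-step (sym-passable x)   = ⟶-step
  carry-step separator-passable = ⟶-step

  finish-step : ∀ {c x a l r} → Restores c x → conf finish (a ∷ l) (c ∷ r) ⟶[ 1 ] conf finish l (a ∷ sym x ∷ r)
  finish-step (unchanged x) = ⟶-step
  finish-step (unmark s)    = ⟶-step
  finish-step unmarkComma   = ⟶-step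

  seek-left : ∀ {c} ys {a l r} → All Passable (c ∷ ys) →
              conf seek (ys ++ a ∷ l) (c ∷ r) ⟶[ length ys + 1 ] conf seek l (a ∷ ys ʳ++ c ∷ r)
  seek-left []       (pc ∷ [])  = seek-step pc
  seek-left (y ∷ ys) (pc ∷ pys) = seek-step pc ▸ seek-left ys pys

  carry-right : ∀ s xs {l} → All Passable xs → conf (carry s) l xs ⟶[ length xs ] conf (carry s) (xs ʳ++ l) []
  carry-right s []       []         = ⟶-refl
  carry-right s (x ∷ xs) (px ∷ pxs) = carry-step px ▸ carry-right s xs pxs

  deposit-and-seek : ∀ s ys {l} → All Passable ys →
    conf (carry s) (ys ++ marked s ∷ l) [] ⟶[ length ys + 2 ] conf copy (marked s ∷ l) (ys ʳ++ sym s ∷ [])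
  deposit-and-seek s []       []         = ⟶-step ▸ ⟶-step
  deposit-and-seek s (y ∷ ys) (py ∷ pys) =
    weaken (ℕ.≤-reflexive (cong suc (ℕ.+-assoc (length ys) 1 1))) (⟶-step ▸ seek-left ys (py ∷ pys) ▸ ⟶-step)

  copy-symbol : ∀ s Z {l} → All Passable Z →
    conf copy l (sym s ∷ Z) ⟶[ 1 + (length Z + (length Z + 2)) ] conf copy (marked s ∷ l) (Z ++ sym s ∷ [])
  copy-symbol s Z {l} pZ = ⟶-step ▸ carry-right s Z pZ ▸ back
    where
    back : conf (carry s) (Z ʳ++ marked s ∷ l) [] ⟶[ length Z + 2 ] conf copy (marked s ∷ l) (Z ++ sym s ∷ [])
    back = subst₂ (λ n κ → conf (carry s) (Z ʳ++ marked s ∷ l) [] ⟶[ n ] κ)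
             (cong (_+ 2) (length-reverse Z)) (cong (conf copy (marked s ∷ l)) (ʳ++-ʳ++ Z {[]}))
             (subst (λ t → conf (carry s) t [] ⟶[ length (reverse Z) + 2 ] conf copy (marked s ∷ l) (reverse Z ʳ++ sym s ∷ []))
               (≡.sym (ʳ++-defn Z))
               (deposit-and-seek s (reverse Z) (All-ʳ++⁺ pZ [])))

  copy-loop-step : ∀ s d rem {X} →
    conf copy (map marked d ʳ++ X) (map sym (s ∷ rem) ++ separator ∷ map sym (glue ++ d))
      ⟶[ 2 * length (d ++ s ∷ rem) + 11 ]
    conf copy (map marked (d ++ s ∷ []) ʳ++ X) (map sym rem ++ separator ∷ map sym (glue ++ d ++ s ∷ []))
  copy-loop-step s d rem {X} =
    subst₂ (λ n κ → conf copy (map marked d ʳ++ X) (sym s ∷ Z) ⟶[ n ] κ)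
      cost (cong₂ (conf copy) marked-tape copied-tape) (copy-symbol s Z passable)
    where
    open ≡-Reasoning
    Z = map sym rem ++ separator ∷ map sym (glue ++ d)
    passable : All Passable Z
    passable = All.++⁺ (all-sym-passable rem) (separator-passable ∷ all-sym-passable (glue ++ d))
    marked-tape : marked s ∷ map marked d ʳ++ X ≡ map marked (d ++ s ∷ []) ʳ++ X
    marked-tape = begin
      marked s ∷ map marked d ʳ++ X         ≡⟨ ++-ʳ++ (map marked d) ⟨
      (map marked d ++ marked s ∷ []) ʳ++ X ≡⟨ cong (_ʳ++ X) (map-++ _ d (s ∷ [])) ⟨
      map marked (d ++ s ∷ []) ʳ++ X        ∎
    copied-tape : Z ++ sym s ∷ [] ≡ map sym rem ++ separator ∷ map sym (glue ++ d ++ s ∷ [])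
    copied-tape = begin
      Z ++ sym s ∷ []
        ≡⟨ ++-assoc (map sym rem) _ _ ⟩
      map sym rem ++ separator ∷ map sym (glue ++ d) ++ sym s ∷ []
        ≡⟨ cong (λ t → map sym rem ++ separator ∷ t) (map-++ _ (glue ++ d) (s ∷ [])) ⟨
      map sym rem ++ separator ∷ map sym ((glue ++ d) ++ s ∷ [])
        ≡⟨ cong (λ t → map sym rem ++ separator ∷ map sym t) (++-assoc glue d (s ∷ [])) ⟩
      map sym rem ++ separator ∷ map sym (glue ++ d ++ s ∷ [])
        ∎
    arithmetic : ∀ a b → 1 + ((b + suc (4 + a)) + ((b + suc (4 + a)) + 2)) ≡ 2 * (a + suc b) + 11
    arithmetic = solve-∀
    cost : 1 + (length Z + (length Z + 2)) ≡ 2 * length (d ++ s ∷ rem) + 11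
    cost rewrite length-++ (map (Tile.sym {Aux}) rem) {separator ∷ map sym (glue ++ d)}
               | length-map (Tile.sym {Aux}) rem | length-map (Tile.sym {Aux}) (glue ++ d) | length-++ d {s ∷ rem}
               = arithmetic (length d) (length rem)

  copy-loop : ∀ d rem {v X} → d ++ rem ≡ v →
    conf copy (map marked d ʳ++ X) (map sym rem ++ separator ∷ map sym (glue ++ d))
      ⟶[ length rem * (2 * length v + 11) ]
    conf copy (map marked v ʳ++ X) (separator ∷ map sym (glue ++ v))
  copy-loop d []        refl rewrite ++-identityʳ d = ⟶-refl
  copy-loop d (s ∷ rem) refl = copy-loop-step s d rem ▸ copy-loop (d ++ s ∷ []) rem (++-assoc d (s ∷ []) rem)

  append-and-seek : ∀ xs {a X} →
    conf append₀ (map sym xs ʳ++ a ∷ X) [] ⟶[ length xs + 9 ] conf seek X (a ∷ map sym xs ++ separator ∷ map sym glue)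
  append-and-seek xs {a} {X} =
    weaken (ℕ.≤-reflexive cost)
      (subst₂ (λ l t → conf append₀ l [] ⟶[ 5 + (length ys + 1) ] conf seek X (a ∷ t))
        (≡.sym (ʳ++-defn (map sym xs))) (ʳ++-ʳ++ (map sym xs) {[]})
        (append-phase ▸ seek-left ys (sym-passable sDel ∷ passable)))
    where
    ys = sym sZero ∷ sym sHalf ∷ separator ∷ reverse (map sym xs)
    passable : All Passable ys
    passable = sym-passable _ ∷ sym-passable _ ∷ separator-passable ∷ All-ʳ++⁺ (all-sym-passable xs) []
    arithmetic : ∀ n → 5 + (3 + n + 1) ≡ n + 9
    arithmetic = solve-∀
    cost : 5 + (length ys + 1) ≡ length xs + 9
    cost rewrite length-reverse (map (Tile.sym {Aux}) xs) | length-map (Tile.sym {Aux}) xs = arithmetic (length xs)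

  finish-restoring : ∀ {c x} cs {xs r} → Restores c x → Pointwise Restores cs xs →
    conf finish (cs ++ leftEnd ∷ []) (c ∷ r) ⟶[ length cs + 2 ] conf halt [] (sym sJoin ∷ map sym (x ∷ xs) ʳ++ r)
  finish-restoring []        rc []          = finish-step rc ▸ ⟶-step
  finish-restoring (c′ ∷ cs) rc (rc′ ∷ rcs) = finish-step rc ▸ finish-restoring cs rc′ rcs

  finish-phase : ∀ cs {xs r} → Pointwise Restores cs xs →
    conf copy (cs ++ leftEnd ∷ []) (separator ∷ r) ⟶[ length cs + 2 ] conf halt [] (sym sJoin ∷ map sym xs ʳ++ sym sDel ∷ r)
  finish-phase []       []         = ⟶-step ▸ ⟶-step
  finish-phase (c ∷ cs) (rc ∷ rcs) = ⟶-step ▸ finish-restoring cs rc rcs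

  no-comma-run : ∀ w → All NotComma w →
    initialₘ w ⟶[ length w + 2 + (suc (length w) + 9 + 1) ]
    conf halt [] (leftEnd ∷ map sym (sDel ∷ w) ++ separator ∷ map sym glue)
  no-comma-run w nw =
    subst (initialₘ w ⟶[ length w + 2 ]_) (cong (λ t → conf append₀ (t ʳ++ leftEnd ∷ []) []) (map-markComma (refl ∷ nw)))
      (shift-phase pairToTautology w)
    ▸ append-and-seek (sDel ∷ w)
    ▸ ⟶-step

  module _ (u : List Sym) {c : Sym} (v : List Sym) where
    private
      w = u ++ c ∷ v
      U = map markComma (sDel ∷ u)
      cells = map marked v ʳ++ commaMark ∷ reverse U
      restored = v ʳ++ sMeet ∷ reverse (sDel ∷ map replaceComma u)

    shifted-tape : isComma c ≡ true → All NotComma v →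
                   map markComma (sDel ∷ w) ʳ++ leftEnd ∷ [] ≡ map sym v ʳ++ commaMark ∷ U ʳ++ leftEnd ∷ []
    shifted-tape comma nv = begin
      map markComma ((sDel ∷ u) ++ c ∷ v) ʳ++ leftEnd ∷ []
        ≡⟨ cong (_ʳ++ leftEnd ∷ []) (map-++ markComma (sDel ∷ u) (c ∷ v)) ⟩
      (U ++ markComma c ∷ map markComma v) ʳ++ leftEnd ∷ []
        ≡⟨ ++-ʳ++ U ⟩
      map markComma v ʳ++ markComma c ∷ U ʳ++ leftEnd ∷ []
        ≡⟨ cong₂ (λ x t → t ʳ++ x ∷ U ʳ++ leftEnd ∷ []) (markComma-comma comma) (map-markComma nv) ⟩
      map sym v ʳ++ commaMark ∷ U ʳ++ leftEnd ∷ []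
        ∎
      where open ≡-Reasoning

    copied-tape : map marked v ʳ++ commaMark ∷ U ʳ++ leftEnd ∷ [] ≡ cells ++ leftEnd ∷ []
    copied-tape = begin
      map marked v ʳ++ commaMark ∷ U ʳ++ leftEnd ∷ []        ≡⟨ cong (λ t → map marked v ʳ++ commaMark ∷ t) (ʳ++-defn U) ⟩
      map marked v ʳ++ commaMark ∷ reverse U ++ leftEnd ∷ [] ≡⟨ ʳ++-++ (map marked v) ⟨
      cells ++ leftEnd ∷ []                                  ∎
      where open ≡-Reasoning

    cells-restore : Pointwise Restores cells restored
    cells-restore = Pointwise.ʳ++⁺ (map-marked-restores v)
                      (unmarkComma ∷ Pointwise.reverse⁺ (map-markComma-restores (sDel ∷ u)))

    restored-output : sym sJoin ∷ map sym restored ʳ++ sym sDel ∷ map sym (glue ++ v)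
                      ≡ map sym (tautologyWord (map replaceComma u) v)
    restored-output = cong (sym sJoin ∷_) (begin
      map sym restored ʳ++ map sym Y                                   ≡⟨ map-ʳ++ (Tile.sym {Aux}) restored ⟨
      map sym (restored ʳ++ Y)                                         ≡⟨ cong (map sym) (ʳ++-ʳ++ v) ⟩
      map sym (reverse (sDel ∷ map replaceComma u) ʳ++ sMeet ∷ v ++ Y) ≡⟨ cong (map sym) (ʳ++-ʳ++ (sDel ∷ map replaceComma u) {[]}) ⟩
      map sym (sDel ∷ map replaceComma u ++ sMeet ∷ v ++ Y)            ∎)
      where
      open ≡-Reasoning
      Y = sDel ∷ glue ++ v

    cells-length : length cells + 2 ≡ length w + 3
    cells-length = begin
      length cells + 2                    ≡⟨ cong (_+ 2) length-cells ⟩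
      length v + suc (suc (length u)) + 2 ≡⟨ arithmetic (length u) (length v) ⟩
      length u + suc (length v) + 3       ≡⟨ cong (_+ 3) (length-++ u) ⟨
      length w + 3                        ∎
      where
      open ≡-Reasoning
      length-cells : length cells ≡ length v + suc (suc (length u))
      length-cells = trans (length-ʳ++ (map (λ s → marked s) v))
                       (cong₂ (λ a b → a + suc b) (length-map _ v) (trans (length-reverse U) (length-map markComma (sDel ∷ u))))
      arithmetic : ∀ a b → b + suc (suc a) + 2 ≡ a + suc b + 3
      arithmetic = solve-∀

    tautology-run : isComma c ≡ true → All NotComma v →
      initialₘ w ⟶[ length w + 2 + (length v + 9 + (1 + (length v * (2 * length v + 11) + (length w + 3)))) ]
      conf halt [] (map sym (tautologyWord (map replaceComma u) v))
    tautology-run comma nv =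
      subst (initialₘ w ⟶[ length w + 2 ]_) (cong (λ t → conf append₀ t []) (shifted-tape comma nv))
        (shift-phase pairToTautology w)
      ▸ append-and-seek v
      ▸ ⟶-step
      ▸ subst (λ t → conf copy X (map sym v ++ separator ∷ map sym glue) ⟶[ _ ] conf copy t (separator ∷ map sym (glue ++ v)))
          copied-tape (copy-loop [] v refl)
      ▸ subst₂ (λ n κ → conf copy (cells ++ leftEnd ∷ []) (separator ∷ map sym (glue ++ v)) ⟶[ n ] κ)
          cells-length (cong (conf halt []) restored-output) (finish-phase cells cells-restore)
      where X = commaMark ∷ U ʳ++ leftEnd ∷ []

  tautology-halts : HaltsWithin (λ n → 16 * n ^ 2 + 16)
  tautology-halts w with commaSplit w
  ... | no-comma nw             = _ , weaken (no-comma-cost-bound (length w)) (no-comma-run w nw) , refl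
  ... | last-comma u v comma nv = _ , weaken (copy-cost-bound (length-≤-++-∷ u v)) (tautology-run u v comma nv) , refl

  consequenceToTautology : List Sym → List Sym
  consequenceToTautology = outputWithin compile (λ w → 16 * length w ^ 2 + 16)

  consequenceToTautology-polyTime : PolyTime consequenceToTautology
  consequenceToTautology-polyTime = compile-polyTime 16 2 tautology-halts

  consequenceToTautology-encPair : ∀ α β → consequenceToTautology (encPair α β) ≡ enc (τ α β)
  consequenceToTautology-encPair α β = begin
    consequenceToTautology (enc α ++ sComma ∷ enc β)
      ≡⟨ outputWithin-compile {T = λ w → 16 * length w ^ 2 + 16} halting-run refl refl ⟩
    tautologyWord (map replaceComma (enc α)) (enc β)
      ≡⟨ cong (λ u → tautologyWord u (enc β)) (map-replaceComma (enc-noComma α)) ⟩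
    tautologyWord (enc α) (enc β)
      ≡⟨ enc-τ α β ⟨
    enc (τ α β)
      ∎
    where
    open ≡-Reasoning
    halting-run = weaken (copy-cost-bound (length-≤-++-∷ (enc α) (enc β)))
                    (tautology-run (enc α) (enc β) refl (enc-noComma β))

-- Reducing tautology to consequence

module _ where
  open Run (machine formulaToPair)

  prefix-run : ∀ w → initialₘ w ⟶[ 2 * length w ^ 1 + 2 ] conf halt (map sym (sComma ∷ w) ʳ++ sym sHalf ∷ []) []
  prefix-run w = weaken (ℕ.+-monoˡ-≤ 2 n≤2*n^1) (shift-phase formulaToPair w)
    where
    n≤2*n^1 : length w ≤ 2 * length w ^ 1
    n≤2*n^1 = ℕ.≤-trans (ℕ.≤-reflexive (≡.sym (ℕ.*-identityʳ (length w)))) (ℕ.m≤m+n _ _)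

  prefixHalfComma : List Sym → List Sym
  prefixHalfComma = outputWithin compile (λ w → 2 * length w ^ 1 + 2)

  prefixHalfComma-polyTime : PolyTime prefixHalfComma
  prefixHalfComma-polyTime = compile-polyTime 2 1 λ w → _ , prefix-run w , refl

  prefixHalfComma-output : ∀ w → prefixHalfComma w ≡ sHalf ∷ sComma ∷ w
  prefixHalfComma-output w = outputWithin-compile {T = λ w → 2 * length w ^ 1 + 2} (prefix-run w) refl (begin
    reverse (map sym (sComma ∷ w) ʳ++ sym sHalf ∷ []) ++ [] ≡⟨ ++-identityʳ _ ⟩
    (map sym (sComma ∷ w) ʳ++ sym sHalf ∷ []) ʳ++ []        ≡⟨ ʳ++-ʳ++ (map sym (sComma ∷ w)) ⟩
    sym sHalf ∷ map sym (sComma ∷ w) ++ []                  ≡⟨ cong (sym sHalf ∷_) (++-identityʳ _) ⟩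
    map sym (sHalf ∷ sComma ∷ w)                            ∎)
    where open ≡-Reasoning

proposition5p11 :
    (Σ (List Sym → List Sym) λ f → PolyTime f ×
      (∀ (α β : Formula) → Σ Formula λ τ →
        (f (encPair α β) ≡ enc τ) × ((α ⊨◇ β) ⇔ Tautology τ)))
    ×
    (Σ (List Sym → List Sym) λ g → PolyTime g ×
      (∀ (φ : Formula) → Σ Formula λ α → Σ Formula λ β →
        (g (enc φ) ≡ encPair α β) × (Tautology φ ⇔ (α ⊨◇ β))))
proposition5p11 =
  ( consequenceToTautology , consequenceToTautology-polyTime
  , λ α β → τ α β , consequenceToTautology-encPair α β , ⊨◇⇔Tautology-τ α β )
  ,
  ( prefixHalfComma , prefixHalfComma-polyTime
  , λ φ → chalf , φ , prefixHalfComma-output (enc φ) , Tautology⇔half-⊨◇ φ )
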